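{- For natural numbers $n$, $k\geq 3$ and $k_i\geq 3$ ($1\leq i\leq n$), the total domination polynomials of the graphs $L(n,1)$, $F(n,k)$ and $F(k_1,k_2,\ldots,k_n)$ are unimodal.
   Context: The lollipop graph $L(n,1)$ is the complete graph $K_n$ together with one extra vertex joined by a single edge to one vertex of $K_n$. $S_k$ denotes the star with $k$ vertices. The firecracker $F(k_1,\ldots,k_n)$ is obtained from disjoint stars $S_{k_1},\ldots,S_{k_n}$ by choosing one leaf $\ell_i$ of each $S_{k_i}$ and linking these leaves consecutively (adding the edges $\ell_i\ell_{i+1}$, $1\le i<n$); $F(n,k)=F(k,k,\ldots,k)$ ($n$ copies). A set $D\subseteq V(G)$ is a total dominating set if every vertex is adjacent to some vertex of $D$; the total domination polynomial is $D_t(G,x)=\sum_i d_t(G,i)x^i$ with $d_t(G,i)$ the number of total dominating sets of size $i$. A polynomial $\sum_{k=0}^N a_kx^k$ is unimodal if for some index $j$, $a_0\le a_1\le\cdots\le a_j\ge a_{j+1}\ge\cdots\ge a_N$. -}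

module Defs where

open import Data.Nat using (ℕ; zero; suc; _≤_; _<_; _≡ᵇ_; _<ᵇ_)
import Data.Nat as ℕ
open import Data.Bool using (Bool; true; false; _∧_; _∨_; not)
open import Data.Fin using (Fin; zero; suc; toℕ; splitAt)
open import Data.Fin.Subset using (Subset; _∈_; ∣_∣)
open import Data.Fin.Subset.Properties using (_∈?_)
open import Data.Fin.Properties using (all?; any?)
open import Data.Vec using (Vec; []; _∷_; lookup; replicate; sum)
open import Data.List using (List; []; _∷_; map; _++_; filter; length; upTo)
open import Data.Product using (Σ; ∃; _×_; _,_)
open import Data.Sum using (inj₁; inj₂)
open import Relation.Binary.PropositionalEquality using (_≡_)
open import Relation.Nullary using (Dec)
open import Relation.Nullary.Decidable using (_×-dec_)
open import Data.Bool.Properties using () renaming (_≟_ to _≟ᵇ_)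

-- Simple graphs on vertex set Fin N, adjacency given as a Boolean
-- (symmetric, irreflexive) function.

record Graph : Set where
  field
    N   : ℕ
    adj : Fin N → Fin N → Bool
open Graph public

TotalDominating : (G : Graph) → Subset (N G) → Set
TotalDominating G D = ∀ v → ∃ λ u → u ∈ D × adj G v u ≡ true

totalDominating? : (G : Graph) → (D : Subset (N G)) → Dec (TotalDominating G D)
totalDominating? G D = all? λ v → any? λ u → (u ∈? D) ×-dec (adj G v u ≟ᵇ true)

allSubsets : (m : ℕ) → List (Subset m)
allSubsets zero    = [] ∷ []
allSubsets (suc m) = map (true ∷_) (allSubsets m) ++ map (false ∷_) (allSubsets m)

dt : (G : Graph) → ℕ → ℕ
dt G i = length (filter (λ D → totalDominating? G D ×-dec (∣ D ∣ ℕ.≟ i)) (allSubsets (N G)))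

totalDominationPoly : Graph → List ℕ
totalDominationPoly G = map (dt G) (upTo (suc (N G)))

Unimodal : (deg : ℕ) → (a : ℕ → ℕ) → Set
Unimodal deg a = ∃ λ j → j ≤ deg
  × (∀ i → i < j → a i ≤ a (suc i))
  × (∀ i → j ≤ i → i < deg → a (suc i) ≤ a i)

TDUnimodal : Graph → Set
TDUnimodal G = Unimodal (N G) (dt G)

-- Lollipop L(n,1): vertices 0..n-1 form K_n, vertex n is joined to vertex 0.

lollipop : ℕ → Graph
lollipop n = record { N = suc n ; adj = a }
  where
  a : Fin (suc n) → Fin (suc n) → Bool
  a u v = ((toℕ u <ᵇ n) ∧ (toℕ v <ᵇ n) ∧ not (toℕ u ≡ᵇ toℕ v))
        ∨ ((toℕ u ≡ᵇ n) ∧ (toℕ v ≡ᵇ 0))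
        ∨ ((toℕ u ≡ᵇ 0) ∧ (toℕ v ≡ᵇ n))

-- Vertices are numbered block by block:
-- block i (0-based) has k_i vertices; inside a block, vertex 0 is the
-- centre of the star S_{k_i}, all other vertices are leaves, and vertex 1
-- is the chosen leaf ℓ_i.  Chosen leaves of consecutive blocks are adjacent.

decode : ∀ {n} (ks : Vec ℕ n) → Fin (sum ks) → Σ (Fin n) (λ i → Fin (lookup ks i))
decode (k ∷ ks) x with splitAt k x
... | inj₁ j = zero , j
... | inj₂ y with decode ks y
...   | i , j = suc i , j

firecrackerAdj : ∀ {n} → (Σ (Fin n) λ _ → ℕ) → (Σ (Fin n) λ _ → ℕ) → Bool
firecrackerAdj (i , a) (j , b) =
    ((toℕ i ≡ᵇ toℕ j) ∧ (((a ≡ᵇ 0) ∧ not (b ≡ᵇ 0)) ∨ (not (a ≡ᵇ 0) ∧ (b ≡ᵇ 0))))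
  ∨ ((a ≡ᵇ 1) ∧ (b ≡ᵇ 1) ∧ ((suc (toℕ i) ≡ᵇ toℕ j) ∨ (suc (toℕ j) ≡ᵇ toℕ i)))

firecracker : ∀ {n} → Vec ℕ n → Graph
firecracker {n} ks = record { N = sum ks ; adj = a }
  where
  a : Fin (sum ks) → Fin (sum ks) → Bool
  a u v with decode ks u | decode ks v
  ... | i , x | j , y = firecrackerAdj (i , toℕ x) (j , toℕ y)

firecrackerUniform : ℕ → ℕ → Graph
firecrackerUniform n k = firecracker (replicate n k)

module Submission where

-- A total dominating set of L(n,1) (vertex 0 of K_n carrying the pendant edge) must contain vertex 0,
-- the only neighbour of the pendant vertex, and some vertex ≠ 0, to dominate vertex 0; conversely such a
-- set is total dominating, so D_t(L(n,1), x) = x ((1 + x)^n − 1). In a firecracker with all k_i ≥ 3,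
-- a leaf of S_{k_i} other than ℓ_i has only the centre as neighbour, and the centre only the leaves; so the
-- total dominating sets are exactly the unions of sets containing the centre and a leaf of each star, and
-- D_t(F(k_1,…,k_n), x) = ∏ x ((1 + x)^(k_i − 1) − 1).
-- All these coefficient sequences are Pólya frequency sequences of order 2: PF₂ is closed under products,
-- because the Toeplitz matrix of a PF₂ sequence is TP₂ and TP₂ is preserved by matrix products
-- (Cauchy–Binet for 2 × 2 minors), and under p ↦ x p and p ↦ p − p(0). A PF₂ sequence is unimodal,
-- since a_{j+1} < a_j forces a_{j+m+1} ≤ a_{j+m} for all m.

open import Defs
open import Level using (0ℓ)
open import Data.Nat using (ℕ; zero; suc; _+_; _*_; _≤_; _<_; z≤n; s≤s; s≤s⁻¹; z<s; _≟_; _<ᵇ_; _≡ᵇ_; >-nonZero)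
open import Data.Nat.Properties
open import Data.Nat.Tactic.RingSolver using (solve-∀)
open import Data.Bool using (Bool; true; false; _∧_; _∨_; not; T)
open import Data.Bool.Properties using (T-≡; T-∨; T-∧) renaming (_≟_ to _≟ᵇ_)
open import Data.Vec using (Vec; []; _∷_; lookup; sum; take; drop; replicate; here; there)
open import Data.Vec.Properties
  using (take++drop≡id; lookup-++ˡ; lookup-++ʳ; []=⇒lookup; lookup⇒[]=; lookup-replicate)
open import Data.Fin using (Fin; zero; suc; toℕ; fromℕ; fromℕ<; _↑ˡ_; _↑ʳ_; splitAt)
open import Data.Fin.Properties
  using (toℕ-injective; toℕ-fromℕ; toℕ-fromℕ<; toℕ<n; all?; ∀-cons; splitAt-↑ˡ; splitAt-↑ʳ; splitAt⁻¹-↑ˡ; splitAt⁻¹-↑ʳ)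
open import Data.Fin.Subset using (Subset; _∈_; ∣_∣; Nonempty)
open import Data.Fin.Subset.Properties using (nonempty?; ∣p∣≤n; x∈p⇒∣p-x∣<∣p∣; Empty-unique; ∣⊥∣≡0)
open import Data.List using ([]; _∷_; map; _++_; filter; length)
open import Data.List.Properties using (filter-++; length-++; filter-≐; filter-none; length-map)
open import Data.List.Relation.Unary.All using (universal)
open import Data.Product using (∃; ∃₂; _×_; _,_; proj₁; proj₂)
open import Data.Sum using (_⊎_; inj₁; inj₂)
open import Data.Empty using (⊥)
open import Data.Unit using (tt)
open import Function using (_∘_; Equivalence)
open import Relation.Binary.PropositionalEquality
open import Relation.Nullary using (Dec; yes; no; ¬_; does; contradiction)
open import Relation.Nullary.Decidable using (_×-dec_)
open import Relation.Unary using (Pred; Decidable)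
open import Relation.Unary.Properties using (U?)
open Equivalence using (to; from)

-- Finite sums

∑ : ℕ → (ℕ → ℕ) → ℕ
∑ zero    f = 0
∑ (suc n) f = f 0 + ∑ n (f ∘ suc)

∑-cong : ∀ n {f g : ℕ → ℕ} → (∀ t → f t ≡ g t) → ∑ n f ≡ ∑ n g
∑-cong zero    f≗g = refl
∑-cong (suc n) f≗g = cong₂ _+_ (f≗g 0) (∑-cong n (f≗g ∘ suc))

∑-mono-≤ : ∀ n {f g : ℕ → ℕ} → (∀ t → f t ≤ g t) → ∑ n f ≤ ∑ n g
∑-mono-≤ zero    f≤g = z≤n
∑-mono-≤ (suc n) f≤g = +-mono-≤ (f≤g 0) (∑-mono-≤ n (f≤g ∘ suc))

∑-distrib-+ : ∀ n (f g : ℕ → ℕ) → ∑ n (λ t → f t + g t) ≡ ∑ n f + ∑ n g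
∑-distrib-+ zero    f g = refl
∑-distrib-+ (suc n) f g
  rewrite ∑-distrib-+ n (f ∘ suc) (g ∘ suc) = interchange (f 0) (g 0) _ _
  where
  interchange : ∀ a b c d → a + b + (c + d) ≡ a + c + (b + d)
  interchange = solve-∀

*-distribˡ-∑ : ∀ n c (f : ℕ → ℕ) → c * ∑ n f ≡ ∑ n (λ t → c * f t)
*-distribˡ-∑ zero    c f = *-zeroʳ c
*-distribˡ-∑ (suc n) c f = trans (*-distribˡ-+ c (f 0) _) (cong (c * f 0 +_) (*-distribˡ-∑ n c (f ∘ suc)))

∑-zero : ∀ n {f : ℕ → ℕ} → (∀ t → t < n → f t ≡ 0) → ∑ n f ≡ 0
∑-zero zero    f≡0 = refl
∑-zero (suc n) f≡0 rewrite f≡0 0 z<s = ∑-zero n (λ t t<n → f≡0 (suc t) (s≤s t<n))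

∑-split : ∀ m n (f : ℕ → ℕ) → ∑ (m + n) f ≡ ∑ m f + ∑ n (λ t → f (m + t))
∑-split zero    n f = refl
∑-split (suc m) n f rewrite ∑-split m n (f ∘ suc) = sym (+-assoc (f 0) _ _)

-- Totally positive kernels and Pólya frequency sequences

TP₂ : (ℕ → ℕ → ℕ) → Set
TP₂ A = ∀ r₁ r₂ t₁ t₂ → r₁ ≤ r₂ → t₁ ≤ t₂ → A r₁ t₂ * A r₂ t₁ ≤ A r₁ t₁ * A r₂ t₂

_⊙[_]_ : (ℕ → ℕ → ℕ) → ℕ → (ℕ → ℕ → ℕ) → ℕ → ℕ → ℕ
(A ⊙[ N ] B) r s = ∑ N (λ t → A r t * B t s)

dropColumn : (ℕ → ℕ → ℕ) → ℕ → ℕ → ℕ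
dropColumn A r t = A r (suc t)

dropRow : (ℕ → ℕ → ℕ) → ℕ → ℕ → ℕ
dropRow B t s = B (suc t) s

TP₂-dropColumn : ∀ A → TP₂ A → TP₂ (dropColumn A)
TP₂-dropColumn A tpA r₁ r₂ t₁ t₂ r≤ t≤ = tpA r₁ r₂ (suc t₁) (suc t₂) r≤ (s≤s t≤)

TP₂-dropRow : ∀ B → TP₂ B → TP₂ (dropRow B)
TP₂-dropRow B tpB t₁ t₂ s₁ s₂ t≤ s≤ = tpB (suc t₁) (suc t₂) s₁ s₂ (s≤s t≤) s≤

rearrangement : ∀ α α' β β' → α' ≤ α → β' ≤ β → α * β' + α' * β ≤ α * β + α' * β'
rearrangement α α' β β' α'≤α β'≤β with m≤n⇒∃[o]m+o≡n α'≤α | m≤n⇒∃[o]m+o≡n β'≤β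
... | p , refl | q , refl = subst ((α' + p) * β' + α' * (β' + q) ≤_) (expand α' p β' q) (m≤m+n _ (p * q))
  where
  expand : ∀ a p b q → (a + p) * b + a * (b + q) + p * q ≡ (a + p) * (b + q) + a * b
  expand = solve-∀

-- The cross terms that arise when the summand t = 0 is split off every entry of A ⊙[ 1 + N ] B.
TP₂-⊙-crossTerms : ∀ N A B → TP₂ A → TP₂ B → ∀ r₁ r₂ s₁ s₂ → r₁ ≤ r₂ → s₁ ≤ s₂ →
  let P = dropColumn A ⊙[ N ] dropRow B in
  A r₁ 0 * B 0 s₂ * P r₂ s₁ + A r₂ 0 * B 0 s₁ * P r₁ s₂ ≤ A r₁ 0 * B 0 s₁ * P r₂ s₂ + A r₂ 0 * B 0 s₂ * P r₁ s₁
TP₂-⊙-crossTerms N A B tpA tpB r₁ r₂ s₁ s₂ r≤ s≤ =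
  subst₂ _≤_ (sumOfScaled (A r₁ 0 * B 0 s₂) (A r₂ 0 * B 0 s₁)) (sumOfScaled (A r₁ 0 * B 0 s₁) (A r₂ 0 * B 0 s₂))
    (∑-mono-≤ N termwise)
  where
  sumOfScaled : ∀ c d {f g : ℕ → ℕ} → ∑ N (λ t → c * f t + d * g t) ≡ c * ∑ N f + d * ∑ N g
  sumOfScaled c d {f} {g} = trans (∑-distrib-+ N _ _) (sym (cong₂ _+_ (*-distribˡ-∑ N c f) (*-distribˡ-∑ N d g)))
  termwise : ∀ t → A r₁ 0 * B 0 s₂ * (A r₂ (suc t) * B (suc t) s₁) + A r₂ 0 * B 0 s₁ * (A r₁ (suc t) * B (suc t) s₂)
                 ≤ A r₁ 0 * B 0 s₁ * (A r₂ (suc t) * B (suc t) s₂) + A r₂ 0 * B 0 s₂ * (A r₁ (suc t) * B (suc t) s₁)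
  termwise t = subst₂ _≤_ (regroup a₁ a₂ b₁ b₂ A₁ A₂ B₁ B₂) (regroup a₁ a₂ b₂ b₁ A₁ A₂ B₂ B₁)
    (rearrangement (a₁ * A₂) (a₂ * A₁) (b₁ * B₂) (b₂ * B₁)
      (subst (_≤ a₁ * A₂) (*-comm A₁ a₂) (tpA r₁ r₂ 0 (suc t) r≤ z≤n))
      (tpB 0 (suc t) s₁ s₂ z≤n s≤))
    where
    a₁ a₂ A₁ A₂ b₁ b₂ B₁ B₂ : ℕ
    a₁ = A r₁ 0 ; a₂ = A r₂ 0 ; A₁ = A r₁ (suc t) ; A₂ = A r₂ (suc t)
    b₁ = B 0 s₁ ; b₂ = B 0 s₂ ; B₁ = B (suc t) s₁ ; B₂ = B (suc t) s₂
    regroup : ∀ a₁ a₂ b₁ b₂ A₁ A₂ B₁ B₂ →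
              a₁ * A₂ * (b₂ * B₁) + a₂ * A₁ * (b₁ * B₂) ≡ a₁ * b₂ * (A₂ * B₁) + a₂ * b₁ * (A₁ * B₂)
    regroup = solve-∀

TP₂-⊙ : ∀ N A B → TP₂ A → TP₂ B → TP₂ (A ⊙[ N ] B)
TP₂-⊙ zero    A B tpA tpB r₁ r₂ s₁ s₂ r≤ s≤ = z≤n
TP₂-⊙ (suc N) A B tpA tpB r₁ r₂ s₁ s₂ r≤ s≤ =
  subst₂ _≤_ (sym (expand (A r₁ 0) (A r₂ 0) (B 0 s₁) (B 0 s₂) (P r₁ s₂) (P r₂ s₁)))
             (sym (expand' (A r₁ 0) (A r₂ 0) (B 0 s₁) (B 0 s₂) (P r₁ s₁) (P r₂ s₂)))
    (+-mono-≤ (+-monoʳ-≤ (A r₁ 0 * A r₂ 0 * (B 0 s₁ * B 0 s₂)) (TP₂-⊙-crossTerms N A B tpA tpB r₁ r₂ s₁ s₂ r≤ s≤))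
              (TP₂-⊙ N (dropColumn A) (dropRow B) (TP₂-dropColumn A tpA) (TP₂-dropRow B tpB) r₁ r₂ s₁ s₂ r≤ s≤))
  where
  P : ℕ → ℕ → ℕ
  P = dropColumn A ⊙[ N ] dropRow B
  expand : ∀ a₁ a₂ b₁ b₂ X Y →
           (a₁ * b₂ + X) * (a₂ * b₁ + Y) ≡ a₁ * a₂ * (b₁ * b₂) + (a₁ * b₂ * Y + a₂ * b₁ * X) + X * Y
  expand = solve-∀
  expand' : ∀ a₁ a₂ b₁ b₂ X Y →
            (a₁ * b₁ + X) * (a₂ * b₂ + Y) ≡ a₁ * a₂ * (b₁ * b₂) + (a₁ * b₁ * Y + a₂ * b₂ * X) + X * Y
  expand' = solve-∀

-- toeplitz a r t = a (r ∸ t) for t ≤ r and 0 otherwise.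
toeplitz : (ℕ → ℕ) → ℕ → ℕ → ℕ
toeplitz a r       zero    = a r
toeplitz a zero    (suc t) = 0
toeplitz a (suc r) (suc t) = toeplitz a r t

toeplitz-diagonal : ∀ a s u → toeplitz a (s + u) s ≡ a u
toeplitz-diagonal a zero    u = refl
toeplitz-diagonal a (suc s) u = toeplitz-diagonal a s u

toeplitz-shift : ∀ a s r t → toeplitz a (s + r) (s + t) ≡ toeplitz a r t
toeplitz-shift a zero    r t = refl
toeplitz-shift a (suc s) r t = toeplitz-shift a s r t

toeplitz-above : ∀ a {r t} → r < t → toeplitz a r t ≡ 0
toeplitz-above a {zero}  {suc t} r<t       = refl
toeplitz-above a {suc r} {suc t} (s≤s r<t) = toeplitz-above a r<t

-- Pólya frequency sequences of order 2: log-concave with no internal zeros.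
PF₂ : (ℕ → ℕ) → Set
PF₂ a = ∀ x d e → a x * a (x + d + e) ≤ a (x + d) * a (x + e)

PF₂-cong : ∀ {a b} → (∀ i → a i ≡ b i) → PF₂ a → PF₂ b
PF₂-cong {a} {b} a≗b pfa x d e
  rewrite sym (a≗b x) | sym (a≗b (x + d + e)) | sym (a≗b (x + d)) | sym (a≗b (x + e)) = pfa x d e

toeplitz-TP₂ : ∀ a → PF₂ a → TP₂ (toeplitz a)
toeplitz-TP₂ a pfa r₁ r₂ zero t₂ r≤ t≤ = firstColumn r≤
  where
  firstColumn : ∀ {r₁ r₂} → r₁ ≤ r₂ → toeplitz a r₁ t₂ * a r₂ ≤ a r₁ * toeplitz a r₂ t₂
  firstColumn {r₁} r≤ with m≤n⇒∃[o]m+o≡n r≤ | t₂ ≤? r₁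
  ... | e , refl | no t₂≰r₁ rewrite toeplitz-above a (≰⇒> t₂≰r₁) = z≤n
  ... | e , refl | yes t₂≤r₁ with m≤n⇒∃[o]m+o≡n t₂≤r₁
  ... | x , refl rewrite toeplitz-diagonal a t₂ x | +-assoc t₂ x e | toeplitz-diagonal a t₂ (x + e) =
    subst₂ (λ u v → a x * a u ≤ a v * a (x + e)) (reassoc x t₂ e) (+-comm x t₂) (pfa x t₂ e)
    where
    reassoc : ∀ x t e → x + t + e ≡ t + (x + e)
    reassoc = solve-∀
toeplitz-TP₂ a pfa zero    r₂      (suc t₁) (suc t₂) r≤       t≤       = z≤n
toeplitz-TP₂ a pfa (suc r₁) (suc r₂) (suc t₁) (suc t₂) (s≤s r≤) (s≤s t≤) = toeplitz-TP₂ a pfa r₁ r₂ t₁ t₂ r≤ t≤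

_⋆_ : (ℕ → ℕ) → (ℕ → ℕ) → ℕ → ℕ
(a ⋆ b) n = ∑ (suc n) (λ t → toeplitz a n t * b t)

toeplitz-⊙ : ∀ a b N s m → s + m < N → (toeplitz a ⊙[ N ] toeplitz b) (s + m) s ≡ (a ⋆ b) m
toeplitz-⊙ a b N s m s+m<N with m≤n⇒∃[o]m+o≡n s+m<N
... | o , refl = begin
    ∑ (suc (s + m) + o) f
      ≡⟨ cong (λ K → ∑ K f) (lengths s m o) ⟩
    ∑ (s + (suc m + o)) f
      ≡⟨ ∑-split s (suc m + o) f ⟩
    ∑ s f + ∑ (suc m + o) (λ u → f (s + u))
      ≡⟨ cong (_+ ∑ (suc m + o) (λ u → f (s + u))) (∑-zero s belowDiagonal) ⟩
    ∑ (suc m + o) (λ u → f (s + u))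
      ≡⟨ ∑-cong (suc m + o) (λ u → cong₂ _*_ (toeplitz-shift a s m u) (toeplitz-diagonal b s u)) ⟩
    ∑ (suc m + o) (λ u → toeplitz a m u * b u)
      ≡⟨ ∑-split (suc m) o (λ u → toeplitz a m u * b u) ⟩
    (a ⋆ b) m + ∑ o (λ u → toeplitz a m (suc m + u) * b (suc m + u))
      ≡⟨ cong ((a ⋆ b) m +_) (∑-zero o aboveDiagonal) ⟩
    (a ⋆ b) m + 0
      ≡⟨ +-identityʳ _ ⟩
    (a ⋆ b) m ∎
  where
  open ≡-Reasoning
  f : ℕ → ℕ
  f t = toeplitz a (s + m) t * toeplitz b t s
  lengths : ∀ s m o → suc (s + m) + o ≡ s + (suc m + o)
  lengths = solve-∀
  belowDiagonal : ∀ t → t < s → f t ≡ 0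
  belowDiagonal t t<s =
    trans (cong (toeplitz a (s + m) t *_) (toeplitz-above b t<s)) (*-zeroʳ (toeplitz a (s + m) t))
  aboveDiagonal : ∀ u → u < o → toeplitz a m (suc m + u) * b (suc m + u) ≡ 0
  aboveDiagonal u _ = cong (_* b (suc m + u)) (toeplitz-above a (s≤s (m≤m+n m u)))

PF₂-⋆ : ∀ a b → PF₂ a → PF₂ b → PF₂ (a ⋆ b)
PF₂-⋆ a b pfa pfb x d e =
  subst₂ _≤_ (cong₂ _*_ (trans (cong (λ r → P r d) (+-comm x d)) (entry d x (s≤s (reassoc₁ x d e))))
                        (entry 0 (x + d + e) ≤-refl))
             (cong₂ _*_ (entry 0 (x + d) (s≤s (m≤m+n (x + d) e)))
                        (trans (cong (λ r → P r d) (reassoc₂ x d e))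
                               (entry d (x + e) (s≤s (≤-reflexive (sym (reassoc₂ x d e)))))))
    (TP₂-⊙ size (toeplitz a) (toeplitz b) (toeplitz-TP₂ a pfa) (toeplitz-TP₂ b pfb)
      (x + d) (x + d + e) 0 d (m≤m+n (x + d) e) z≤n)
  where
  size : ℕ
  size = suc (x + d + e)
  P : ℕ → ℕ → ℕ
  P = toeplitz a ⊙[ size ] toeplitz b
  entry : ∀ s m → s + m < size → P (s + m) s ≡ (a ⋆ b) m
  entry = toeplitz-⊙ a b size
  reassoc₁ : ∀ x d e → d + x ≤ x + d + e
  reassoc₁ x d e = subst (_≤ x + d + e) (+-comm x d) (m≤m+n (x + d) e)
  reassoc₂ : ∀ x d e → x + d + e ≡ d + (x + e)
  reassoc₂ = solve-∀

shift : (ℕ → ℕ) → ℕ → ℕ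
shift f zero    = 0
shift f (suc i) = f i

dropConstant : (ℕ → ℕ) → ℕ → ℕ
dropConstant f zero    = 0
dropConstant f (suc i) = f (suc i)

shift-cong : ∀ {f g} → (∀ i → f i ≡ g i) → ∀ i → shift f i ≡ shift g i
shift-cong f≗g zero    = refl
shift-cong f≗g (suc i) = f≗g i

PF₂-shift : ∀ f → PF₂ f → PF₂ (shift f)
PF₂-shift f pff zero    d e = z≤n
PF₂-shift f pff (suc x) d e = pff x d e

PF₂-dropConstant : ∀ f → PF₂ f → PF₂ (dropConstant f)
PF₂-dropConstant f pff zero    d e = z≤n
PF₂-dropConstant f pff (suc x) d e = pff (suc x) d e

PF₂-vanishingFrom2 : ∀ f → (∀ j → f (2 + j) ≡ 0) → PF₂ f
PF₂-vanishingFrom2 f f≡0 x zero    e rewrite +-identityʳ x = ≤-refl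
PF₂-vanishingFrom2 f f≡0 x (suc d) zero
  rewrite +-identityʳ (x + suc d) | +-identityʳ x = ≤-reflexive (*-comm (f x) (f (x + suc d)))
PF₂-vanishingFrom2 f f≡0 x (suc d) (suc e) = subst (_≤ f (x + suc d) * f (x + suc e)) (sym lhs≡0) z≤n
  where
  reassoc : ∀ x d e → x + suc d + suc e ≡ 2 + (x + d + e)
  reassoc = solve-∀
  lhs≡0 : f x * f (x + suc d + suc e) ≡ 0
  lhs≡0 = trans (cong (λ i → f x * f i) (reassoc x d e))
                (trans (cong (f x *_) (f≡0 (x + d + e))) (*-zeroʳ (f x)))

⋆-distribˡ-+ : ∀ a b c n → (a ⋆ (λ t → b t + c t)) n ≡ (a ⋆ b) n + (a ⋆ c) n
⋆-distribˡ-+ a b c n =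
  trans (∑-cong (suc n) (λ t → *-distribˡ-+ (toeplitz a n t) (b t) (c t)))
        (∑-distrib-+ (suc n) (λ t → toeplitz a n t * b t) (λ t → toeplitz a n t * c t))

⋆-congˡ : ∀ a {b c} n → (∀ t → b t ≡ c t) → (a ⋆ b) n ≡ (a ⋆ c) n
⋆-congˡ a n b≗c = ∑-cong (suc n) (λ t → cong (toeplitz a n t *_) (b≗c t))

⋆-shift : ∀ a b n → (a ⋆ shift b) n ≡ shift (a ⋆ b) n
⋆-shift a b zero    = trans (+-identityʳ _) (*-zeroʳ (a 0))
⋆-shift a b (suc n) = cong (_+ (a ⋆ b) n) (*-zeroʳ (a (suc n)))

⋆-constant : ∀ a b n → (∀ t → b (suc t) ≡ 0) → (a ⋆ b) n ≡ a n * b 0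
⋆-constant a b n b≡0 =
  trans (cong (a n * b 0 +_) (∑-zero n higherTerms)) (+-identityʳ _)
  where
  higherTerms : ∀ t → t < n → toeplitz a n (suc t) * b (suc t) ≡ 0
  higherTerms t _ = trans (cong (toeplitz a n (suc t) *_) (b≡0 t)) (*-zeroʳ (toeplitz a n (suc t)))

-- Unimodality

firstDescent : ∀ (a : ℕ → ℕ) deg →
               ∃ λ j → j ≤ deg × (∀ i → i < j → a i ≤ a (suc i)) × (j < deg → a (suc j) < a j)
firstDescent a zero = 0 , z≤n , (λ _ ()) , (λ ())
firstDescent a (suc deg) with firstDescent a deg
... | j , j≤deg , ascent , descent with m≤n⇒m<n∨m≡n j≤deg
...   | inj₁ j<deg = j , m≤n⇒m≤1+n j≤deg , ascent , (λ _ → descent j<deg)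
...   | inj₂ refl with a (suc j) <? a j
...     | yes a[j+1]<a[j] = j , n≤1+n j , ascent , (λ _ → a[j+1]<a[j])
...     | no  a[j+1]≮a[j] = suc j , ≤-refl , ascent′ , (λ j+1<j+1 → contradiction j+1<j+1 (n≮n (suc j)))
  where
  ascent′ : ∀ i → i < suc j → a i ≤ a (suc i)
  ascent′ i (s≤s i≤j) with m≤n⇒m<n∨m≡n i≤j
  ... | inj₁ i<j  = ascent i i<j
  ... | inj₂ refl = ≮⇒≥ a[j+1]≮a[j]

PF₂-descentPersists : ∀ a → PF₂ a → ∀ j → a (suc j) < a j → ∀ m → a (suc (j + m)) ≤ a (j + m)
PF₂-descentPersists a pfa j a[j+1]<a[j] m = *-cancelˡ-≤ (a j) {{>-nonZero (≤-<-trans z≤n a[j+1]<a[j])}} (begin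
  a j * a (suc (j + m))   ≡⟨ cong (λ i → a j * a i) (+-comm 1 (j + m)) ⟩
  a j * a (j + m + 1)     ≤⟨ pfa j m 1 ⟩
  a (j + m) * a (j + 1)   ≡⟨ cong (λ i → a (j + m) * a i) (+-comm j 1) ⟩
  a (j + m) * a (suc j)   ≤⟨ *-monoʳ-≤ (a (j + m)) (<⇒≤ a[j+1]<a[j]) ⟩
  a (j + m) * a j         ≡⟨ *-comm (a (j + m)) (a j) ⟩
  a j * a (j + m)         ∎)
  where open ≤-Reasoning

PF₂⇒unimodal : ∀ a → PF₂ a → ∀ deg → Unimodal deg a
PF₂⇒unimodal a pfa deg with firstDescent a deg
... | j , j≤deg , ascent , descent = j , j≤deg , ascent , descentAfter
  where
  descentAfter : ∀ i → j ≤ i → i < deg → a (suc i) ≤ a i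
  descentAfter i j≤i i<deg with m≤n⇒∃[o]m+o≡n j≤i
  ... | m , refl = PF₂-descentPersists a pfa j (descent (≤-<-trans j≤i i<deg)) m

-- Counting subsets by size

filter-map : ∀ {A B : Set} {P : Pred B 0ℓ} (P? : Decidable P) (f : A → B) xs →
             filter P? (map f xs) ≡ map f (filter (P? ∘ f) xs)
filter-map P? f []       = refl
filter-map P? f (x ∷ xs) with does (P? (f x))
... | true  = cong (f x ∷_) (filter-map P? f xs)
... | false = filter-map P? f xs

-- By definition, dt G = count (totalDominating? G).
count : ∀ {m} {P : Pred (Subset m) 0ℓ} → Decidable P → ℕ → ℕ
count {m} P? i = length (filter (λ D → P? D ×-dec (∣ D ∣ ≟ i)) (allSubsets m))

module _ {m} {P Q : Pred (Subset m) 0ℓ} (P? : Decidable P) (Q? : Decidable Q) where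

  count-cong : ∀ i → (∀ D → ∣ D ∣ ≡ i → P D → Q D) → (∀ D → ∣ D ∣ ≡ i → Q D → P D) → count P? i ≡ count Q? i
  count-cong i P⇒Q Q⇒P = cong length (filter-≐ _ _
    ((λ (p , ∣D∣≡i) → P⇒Q _ ∣D∣≡i p , ∣D∣≡i) , (λ (q , ∣D∣≡i) → Q⇒P _ ∣D∣≡i q , ∣D∣≡i)) (allSubsets m))

count-none : ∀ {m} {P : Pred (Subset m) 0ℓ} (P? : Decidable P) i → (∀ D → ∣ D ∣ ≡ i → ¬ P D) → count P? i ≡ 0
count-none {m} P? i ¬P = cong length (filter-none _ (universal (λ D (p , ∣D∣≡i) → ¬P D ∣D∣≡i p) (allSubsets m)))

count-beyond : ∀ {m} {P : Pred (Subset m) 0ℓ} (P? : Decidable P) i → m < i → count P? i ≡ 0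
count-beyond P? i m<i = count-none P? i (λ D ∣D∣≡i _ → <⇒≢ (≤-<-trans (∣p∣≤n D) m<i) ∣D∣≡i)

count-∷ : ∀ {m} {P : Pred (Subset (suc m)) 0ℓ} (P? : Decidable P) i →
          count P? i ≡ count (P? ∘ (false ∷_)) i + shift (count (P? ∘ (true ∷_))) i
count-∷ {m} {P} P? i = begin
  count P? i
    ≡⟨ cong length (filter-++ sized? (map (true ∷_) (allSubsets m)) (map (false ∷_) (allSubsets m))) ⟩
  length (filter sized? (map (true ∷_) (allSubsets m)) ++ filter sized? (map (false ∷_) (allSubsets m)))
    ≡⟨ length-++ (filter sized? (map (true ∷_) (allSubsets m))) ⟩
  length (filter sized? (map (true ∷_) (allSubsets m))) + length (filter sized? (map (false ∷_) (allSubsets m)))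
    ≡⟨ cong₂ _+_ (trans (lengthFilterMap (true ∷_)) (withTrue i)) (lengthFilterMap (false ∷_)) ⟩
  shift (count (P? ∘ (true ∷_))) i + count (P? ∘ (false ∷_)) i
    ≡⟨ +-comm (shift (count (P? ∘ (true ∷_))) i) (count (P? ∘ (false ∷_)) i) ⟩
  count (P? ∘ (false ∷_)) i + shift (count (P? ∘ (true ∷_))) i ∎
  where
  open ≡-Reasoning
  sized? : Decidable (λ D → P D × ∣ D ∣ ≡ i)
  sized? D = P? D ×-dec (∣ D ∣ ≟ i)
  lengthFilterMap : ∀ f → length (filter sized? (map f (allSubsets m))) ≡ length (filter (sized? ∘ f) (allSubsets m))
  lengthFilterMap f =
    trans (cong length (filter-map sized? f (allSubsets m))) (length-map f (filter (sized? ∘ f) (allSubsets m)))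
  withTrue : ∀ i → length (filter (λ D → P? (true ∷ D) ×-dec (suc ∣ D ∣ ≟ i)) (allSubsets m))
                   ≡ shift (count (P? ∘ (true ∷_))) i
  withTrue zero    = cong length (filter-none _ (universal (λ { D (_ , ()) }) (allSubsets m)))
  withTrue (suc j) = cong length (filter-≐ _ _
    ((λ (p , e) → p , suc-injective e) , (λ (p , e) → p , cong suc e)) (allSubsets m))

count-[]-accept : ∀ {P : Pred (Subset 0) 0ℓ} (P? : Decidable P) → P [] → count P? 0 ≡ 1
count-[]-accept P? p with P? []
... | yes _ = refl
... | no ¬p = contradiction p ¬p

count-take×drop : ∀ k {M} {Q : Pred (Subset k) 0ℓ} {R : Pred (Subset M) 0ℓ} (Q? : Decidable Q) (R? : Decidable R) i →
                  count (λ D → Q? (take k D) ×-dec R? (drop k D)) i ≡ (count R? ⋆ count Q?) i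
count-take×drop zero {M} {Q} Q? R? i =
  trans (onlyR (Q? [])) (sym (⋆-constant (count R?) (count Q?) i (λ t → count-beyond Q? (suc t) (s≤s z≤n))))
  where
  P? : Decidable (λ D → Q [] × _)
  P? D = Q? [] ×-dec R? D
  onlyR : Dec (Q []) → count P? i ≡ count R? i * count Q? 0
  onlyR (yes q) = trans (count-cong P? R? i (λ _ _ → proj₂) (λ _ _ r → q , r))
                        (sym (trans (cong (count R? i *_) (count-[]-accept Q? q)) (*-identityʳ (count R? i))))
  onlyR (no ¬q) = trans (count-none P? i (λ _ _ → ¬q ∘ proj₁))
                        (sym (trans (cong (count R? i *_) (count-none Q? 0 (λ { [] _ → ¬q }))) (*-zeroʳ (count R? i))))
count-take×drop (suc k) {M} {Q} Q? R? i = begin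
  count P? i
    ≡⟨ count-∷ P? i ⟩
  count (P? ∘ (false ∷_)) i + shift (count (P? ∘ (true ∷_))) i
    ≡⟨ cong₂ _+_ (count-take×drop k (Q? ∘ (false ∷_)) R? i)
                 (shift-cong (count-take×drop k (Q? ∘ (true ∷_)) R?) i) ⟩
  (f ⋆ count (Q? ∘ (false ∷_))) i + shift (f ⋆ count (Q? ∘ (true ∷_))) i
    ≡⟨ cong ((f ⋆ count (Q? ∘ (false ∷_))) i +_) (sym (⋆-shift f (count (Q? ∘ (true ∷_))) i)) ⟩
  (f ⋆ count (Q? ∘ (false ∷_))) i + (f ⋆ shift (count (Q? ∘ (true ∷_)))) i
    ≡⟨ sym (⋆-distribˡ-+ f (count (Q? ∘ (false ∷_))) (shift (count (Q? ∘ (true ∷_)))) i) ⟩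
  (f ⋆ (λ t → count (Q? ∘ (false ∷_)) t + shift (count (Q? ∘ (true ∷_))) t)) i
    ≡⟨ ⋆-congˡ f i (λ t → sym (count-∷ Q? t)) ⟩
  (f ⋆ count Q?) i ∎
  where
  open ≡-Reasoning
  f : ℕ → ℕ
  f = count R?
  P? : Decidable (λ D → Q (take (suc k) D) × _)
  P? D = Q? (take (suc k) D) ×-dec R? (drop (suc k) D)

binomials : ℕ → ℕ → ℕ
binomials m = count {m} U?

PF₂-binomials : ∀ m → PF₂ (binomials m)
PF₂-binomials zero    = PF₂-vanishingFrom2 (binomials 0) (λ j → count-beyond U? (2 + j) (s≤s z≤n))
PF₂-binomials (suc m) = PF₂-cong (λ i → sym (pascal i))
  (PF₂-⋆ (binomials m) (binomials 1) (PF₂-binomials m)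
         (PF₂-vanishingFrom2 (binomials 1) (λ j → count-beyond U? (2 + j) (s≤s (s≤s z≤n)))))
  where
  pascal : ∀ i → binomials (suc m) i ≡ (binomials m ⋆ binomials 1) i
  pascal i = trans (count-cong {suc m} U? (λ D → U? (take 1 D) ×-dec U? (drop 1 D)) i
                               (λ _ _ _ → tt , tt) (λ _ _ _ → tt))
                   (count-take×drop 1 {m} U? U? i)

nonempty⇒size≢0 : ∀ {m} (D : Subset m) → Nonempty D → ∣ D ∣ ≢ 0
nonempty⇒size≢0 D (x , x∈D) = >⇒≢ (≤-<-trans z≤n (x∈p⇒∣p-x∣<∣p∣ x∈D))

size≢0⇒nonempty : ∀ {m} (D : Subset m) → ∣ D ∣ ≢ 0 → Nonempty D
size≢0⇒nonempty {m} D ∣D∣≢0 with nonempty? D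
... | yes ne    = ne
... | no  empty = contradiction (trans (cong ∣_∣ (Empty-unique empty)) (∣⊥∣≡0 m)) ∣D∣≢0

count-nonempty : ∀ m i → count {m} nonempty? i ≡ dropConstant (binomials m) i
count-nonempty m zero    = count-none {m} nonempty? 0 (λ D ∣D∣≡0 ne → nonempty⇒size≢0 D ne ∣D∣≡0)
count-nonempty m (suc j) = count-cong {m} nonempty? U? (suc j) (λ _ _ _ → tt)
  (λ D ∣D∣≡1+j _ → size≢0⇒nonempty D (λ ∣D∣≡0 → 1+n≢0 (trans (sym ∣D∣≡1+j) ∣D∣≡0)))

-- Total domination in stars, lollipops and firecrackers

-- A set totally dominates a star whose centre is vertex 0 iff it contains the centre and some leaf.
StarDominating : ∀ {k} → Subset k → Set
StarDominating []      = ⊥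
StarDominating (b ∷ s) = b ≡ true × Nonempty s

starDominating? : ∀ {k} → Decidable (StarDominating {k})
starDominating? []      = no λ ()
starDominating? (b ∷ s) = (b ≟ᵇ true) ×-dec nonempty? s

starDominating⁺ : ∀ {k} (B : Subset k) {c ℓ} → toℕ c ≡ 0 → c ∈ B → toℕ ℓ ≢ 0 → ℓ ∈ B → StarDominating B
starDominating⁺ (b ∷ s) {zero} {zero}  _ here ℓ≢0 _          = contradiction refl ℓ≢0
starDominating⁺ (b ∷ s) {zero} {suc ℓ} _ here _   (there ℓ∈s) = refl , ℓ , ℓ∈s

starDominating⁻ : ∀ {k} (B : Subset k) → StarDominating B →
                  (∃ λ c → toℕ c ≡ 0 × c ∈ B) × (∃ λ ℓ → toℕ ℓ ≢ 0 × ℓ ∈ B)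
starDominating⁻ (true ∷ s) (refl , ℓ , ℓ∈s) = (zero , refl , here) , (suc ℓ , (λ ()) , there ℓ∈s)

count-starDominating : ∀ k i → count {suc k} starDominating? i ≡ shift (count {k} nonempty?) i
count-starDominating k i = trans (count-∷ {k} starDominating? i)
  (cong₂ _+_ (count-none {k} (starDominating? ∘ (false ∷_)) i (λ { _ _ (() , _) }))
             (shift-cong (λ j → count-cong {k} (starDominating? ∘ (true ∷_)) nonempty? j
                                             (λ _ _ → proj₂) (λ _ _ ne → refl , ne)) i))

PF₂-starDominating : ∀ k → PF₂ (count {k} starDominating?)
PF₂-starDominating zero    =
  PF₂-vanishingFrom2 (count {0} starDominating?) (λ j → count-none {0} starDominating? (2 + j) (λ { [] _ () }))
PF₂-starDominating (suc k) = PF₂-cong (λ i → sym (count-starDominating k i))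
  (PF₂-shift (count {k} nonempty?)
    (PF₂-cong (λ i → sym (count-nonempty k i)) (PF₂-dropConstant (binomials k) (PF₂-binomials k))))

-- adj (lollipop n) u v unfolds to lollipopAdjᵇ n (toℕ u) (toℕ v).
lollipopAdjᵇ : ℕ → ℕ → ℕ → Bool
lollipopAdjᵇ n x y = ((x <ᵇ n) ∧ (y <ᵇ n) ∧ not (x ≡ᵇ y)) ∨ ((x ≡ᵇ n) ∧ (y ≡ᵇ 0)) ∨ ((x ≡ᵇ 0) ∧ (y ≡ᵇ n))

lollipopAdjᵇ-pendant : ∀ n y → T (lollipopAdjᵇ n n y) → y ≡ 0
lollipopAdjᵇ-pendant n y edge with to T-∨ edge
... | inj₁ clique = contradiction (<ᵇ⇒< n n (proj₁ (to T-∧ clique))) (n≮n n)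
... | inj₂ stick with to T-∨ stick
...   | inj₁ n→0 = ≡ᵇ⇒≡ y 0 (proj₂ (to T-∧ n→0))
...   | inj₂ 0→n = trans (≡ᵇ⇒≡ y n (proj₂ (to T-∧ 0→n))) (≡ᵇ⇒≡ n 0 (proj₁ (to T-∧ 0→n)))

≤⇒<ᵇ⊎≡ᵇ : ∀ {x n} → x ≤ n → T (x <ᵇ n) ⊎ T (x ≡ᵇ n)
≤⇒<ᵇ⊎≡ᵇ {x} {n} x≤n with m≤n⇒m<n∨m≡n x≤n
... | inj₁ x<n = inj₁ (<⇒<ᵇ x<n)
... | inj₂ x≡n = inj₂ (≡⇒≡ᵇ x n x≡n)

module _ {n : ℕ} where

  lollipop-adj-fromCentre : ∀ (v : Fin (suc n)) → adj (lollipop (suc n)) zero (suc v) ≡ true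
  lollipop-adj-fromCentre v with ≤⇒<ᵇ⊎≡ᵇ (s≤s⁻¹ (toℕ<n v))
  ... | inj₁ v<n = to T-≡ (from T-∨ (inj₁ (from T-∧ (v<n , _))))
  ... | inj₂ v≡n = to T-≡ (from T-∨ (inj₂ v≡n))

  lollipop-adj-toCentre : ∀ (v : Fin (suc n)) → adj (lollipop (suc n)) (suc v) zero ≡ true
  lollipop-adj-toCentre v with ≤⇒<ᵇ⊎≡ᵇ (s≤s⁻¹ (toℕ<n v))
  ... | inj₁ v<n = to T-≡ (from T-∨ (inj₁ (from T-∧ (v<n , _))))
  ... | inj₂ v≡n = to T-≡ (from (T-∨ {(toℕ v <ᵇ n) ∧ true}) (inj₂ (from T-∨ (inj₁ (from T-∧ (v≡n , _))))))

  lollipop-totalDominating⇒ : (D : Subset (suc (suc n))) → TotalDominating (lollipop (suc n)) D → StarDominating D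
  lollipop-totalDominating⇒ (b ∷ s) td = centreIn (td (fromℕ (suc n))) , leafIn (td zero)
    where
    centreIn : ∃ (λ u → u ∈ (b ∷ s) × adj (lollipop (suc n)) (fromℕ (suc n)) u ≡ true) → b ≡ true
    centreIn (zero  , here , _)  = refl
    centreIn (suc u , _ , adj≡) with lollipopAdjᵇ-pendant (suc n) (toℕ (suc u))
      (subst (λ x → T (lollipopAdjᵇ (suc n) x (toℕ (suc u)))) (toℕ-fromℕ (suc n)) (from T-≡ adj≡))
    ... | ()
    leafIn : ∃ (λ u → u ∈ (b ∷ s) × adj (lollipop (suc n)) zero u ≡ true) → Nonempty s
    leafIn (zero  , _ , ())
    leafIn (suc u , there u∈s , _) = u , u∈s

  lollipop-totalDominating⇐ : (D : Subset (suc (suc n))) → StarDominating D → TotalDominating (lollipop (suc n)) D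
  lollipop-totalDominating⇐ (true ∷ s) (refl , ℓ , ℓ∈s) zero    = suc ℓ , there ℓ∈s , lollipop-adj-fromCentre ℓ
  lollipop-totalDominating⇐ (true ∷ s) (refl , ℓ , ℓ∈s) (suc v) = zero , here , lollipop-adj-toCentre v

  dt-lollipop : ∀ i → dt (lollipop (suc n)) i ≡ count {suc (suc n)} starDominating? i
  dt-lollipop i = count-cong (totalDominating? (lollipop (suc n))) starDominating? i
    (λ D _ → lollipop-totalDominating⇒ D) (λ D _ → lollipop-totalDominating⇐ D)

≡ᵇ-refl : ∀ n → (n ≡ᵇ n) ≡ true
≡ᵇ-refl n = to T-≡ (≡⇒≡ᵇ n n refl)

module _ {n : ℕ} (i : Fin n) where

  firecrackerAdj-spoke : ∀ {a b} → a ≡ 0 → b ≢ 0 → firecrackerAdj (i , a) (i , b) ≡ true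
  firecrackerAdj-spoke {b = zero}  refl b≢0 = contradiction refl b≢0
  firecrackerAdj-spoke {b = suc b} refl b≢0 rewrite ≡ᵇ-refl (toℕ i) = refl

  firecrackerAdj-spoke⁻¹ : ∀ {a b} → a ≢ 0 → b ≡ 0 → firecrackerAdj (i , a) (i , b) ≡ true
  firecrackerAdj-spoke⁻¹ {a = zero}  a≢0 refl = contradiction refl a≢0
  firecrackerAdj-spoke⁻¹ {a = suc a} a≢0 refl rewrite ≡ᵇ-refl (toℕ i) = refl

  firecrackerAdj-centre : ∀ j {a b} → a ≡ 0 → firecrackerAdj (i , a) (j , b) ≡ true → i ≡ j × b ≢ 0
  firecrackerAdj-centre j {b = zero}  refl adj≡ with toℕ i ≡ᵇ toℕ j
  firecrackerAdj-centre j {b = zero}  refl () | true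
  firecrackerAdj-centre j {b = zero}  refl () | false
  firecrackerAdj-centre j {b = suc b} refl adj≡ with toℕ i ≡ᵇ toℕ j in i≡ᵇj
  ... | true = toℕ-injective (≡ᵇ⇒≡ (toℕ i) (toℕ j) (from T-≡ i≡ᵇj)) , λ ()

  firecrackerAdj-outerLeaf : ∀ j {a b} → 2 ≤ a → firecrackerAdj (i , a) (j , b) ≡ true → i ≡ j × b ≡ 0
  firecrackerAdj-outerLeaf j {b = zero}  (s≤s (s≤s _)) adj≡ with toℕ i ≡ᵇ toℕ j in i≡ᵇj
  ... | true = toℕ-injective (≡ᵇ⇒≡ (toℕ i) (toℕ j) (from T-≡ i≡ᵇj)) , refl
  firecrackerAdj-outerLeaf j {b = suc b} (s≤s (s≤s _)) adj≡ with toℕ i ≡ᵇ toℕ j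
  firecrackerAdj-outerLeaf j {b = suc b} (s≤s (s≤s _)) () | true
  firecrackerAdj-outerLeaf j {b = suc b} (s≤s (s≤s _)) () | false

encode : ∀ {n} (ks : Vec ℕ n) (i : Fin n) → Fin (lookup ks i) → Fin (sum ks)
encode (k ∷ ks) zero    y = y ↑ˡ sum ks
encode (k ∷ ks) (suc i) y = k ↑ʳ encode ks i y

decode-encode : ∀ {n} (ks : Vec ℕ n) i y → decode ks (encode ks i y) ≡ (i , y)
decode-encode (k ∷ ks) zero    y rewrite splitAt-↑ˡ k y (sum ks) = refl
decode-encode (k ∷ ks) (suc i) y rewrite splitAt-↑ʳ k (sum ks) (encode ks i y) | decode-encode ks i y = refl

encode-decode : ∀ {n} (ks : Vec ℕ n) v → encode ks (proj₁ (decode ks v)) (proj₂ (decode ks v)) ≡ v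
encode-decode (k ∷ ks) v with splitAt k v in eq
... | inj₁ y = splitAt⁻¹-↑ˡ eq
... | inj₂ w = trans (cong (k ↑ʳ_) (encode-decode ks w)) (splitAt⁻¹-↑ʳ eq)

block : ∀ {n} (ks : Vec ℕ n) → Subset (sum ks) → (i : Fin n) → Subset (lookup ks i)
block (k ∷ ks) D zero    = take k D
block (k ∷ ks) D (suc i) = block ks (drop k D) i

lookup-encode : ∀ {n} (ks : Vec ℕ n) D i y → lookup D (encode ks i y) ≡ lookup (block ks D i) y
lookup-encode (k ∷ ks) D zero y =
  trans (cong (λ E → lookup E (y ↑ˡ sum ks)) (sym (take++drop≡id k D))) (lookup-++ˡ (take k D) (drop k D) y)
lookup-encode (k ∷ ks) D (suc i) y =
  trans (cong (λ E → lookup E (k ↑ʳ encode ks i y)) (sym (take++drop≡id k D)))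
        (trans (lookup-++ʳ (take k D) (drop k D) (encode ks i y)) (lookup-encode ks (drop k D) i y))

module _ {n : ℕ} (ks : Vec ℕ n) where

  EveryBlockDominating : Subset (sum ks) → Set
  EveryBlockDominating D = ∀ i → StarDominating (block ks D i)

  everyBlockDominating? : Decidable EveryBlockDominating
  everyBlockDominating? D = all? (λ i → starDominating? (block ks D i))

  ∈-block⁺ : ∀ {D i y} → y ∈ block ks D i → encode ks i y ∈ D
  ∈-block⁺ {D} {i} {y} y∈B = lookup⇒[]= (encode ks i y) D (trans (lookup-encode ks D i y) ([]=⇒lookup y∈B))

  ∈-block⁻ : ∀ {D i y} → encode ks i y ∈ D → y ∈ block ks D i
  ∈-block⁻ {D} {i} {y} e∈D = lookup⇒[]= y (block ks D i) (trans (sym (lookup-encode ks D i y)) ([]=⇒lookup e∈D))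

  -- adj (firecracker ks) u v unfolds to firecrackerAdj (position u) (position v).
  position : Fin (sum ks) → Fin n × ℕ
  position v = proj₁ (decode ks v) , toℕ (proj₂ (decode ks v))

  position-encode : ∀ i y → position (encode ks i y) ≡ (i , toℕ y)
  position-encode i y = cong (λ (j , z) → j , toℕ z) (decode-encode ks i y)

  BlockDominator : Subset (sum ks) → Fin n × ℕ → Set
  BlockDominator D p = ∃₂ λ j (z : Fin (lookup ks j)) → z ∈ block ks D j × firecrackerAdj p (j , toℕ z) ≡ true

  dominatorInBlocks : ∀ {D} i y → (∃ λ u → u ∈ D × adj (firecracker ks) (encode ks i y) u ≡ true) →
                      BlockDominator D (i , toℕ y)
  dominatorInBlocks i y (u , u∈D , adj≡) =
    proj₁ (decode ks u) , proj₂ (decode ks u) ,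
    ∈-block⁻ (subst (_∈ _) (sym (encode-decode ks u)) u∈D) ,
    subst (λ p → firecrackerAdj p (position u) ≡ true) (position-encode i y) adj≡

  dominatorFromBlocks : ∀ {D} v → BlockDominator D (position v) → ∃ λ u → u ∈ D × adj (firecracker ks) v u ≡ true
  dominatorFromBlocks v (j , z , z∈B , adj≡) =
    encode ks j z , ∈-block⁺ z∈B , subst (λ q → firecrackerAdj (position v) q ≡ true) (sym (position-encode j z)) adj≡

  dominatedWithinBlock : ∀ {D} i → StarDominating (block ks D i) → ∀ a → BlockDominator D (i , a)
  dominatedWithinBlock {D} i starDominating a with starDominating⁻ (block ks D i) starDominating | a ≟ 0
  ... | _ , (ℓ , ℓ≢0 , ℓ∈B) | yes a≡0 = i , ℓ , ℓ∈B , firecrackerAdj-spoke i {b = toℕ ℓ} a≡0 ℓ≢0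
  ... | (c , c≡0 , c∈B) , _ | no  a≢0 = i , c , c∈B , firecrackerAdj-spoke⁻¹ i {b = toℕ c} a≢0 c≡0

  -- k_i ≥ 3 provides a leaf other than the linked leaf ℓ_i (local index 1); its only neighbour is the centre.
  firecracker-totalDominating⇒ : (∀ i → 3 ≤ lookup ks i) → ∀ D → TotalDominating (firecracker ks) D →
                                 EveryBlockDominating D
  firecracker-totalDominating⇒ big D td i =
    fromNeighbours (dominatorInBlocks i centre (td (encode ks i centre)))
                   (dominatorInBlocks i outerLeaf (td (encode ks i outerLeaf)))
    where
    centre outerLeaf : Fin (lookup ks i)
    centre    = fromℕ< (≤-trans (s≤s z≤n) (big i))
    outerLeaf = fromℕ< (big i)
    fromNeighbours : BlockDominator D (i , toℕ centre) → BlockDominator D (i , toℕ outerLeaf) →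
                     StarDominating (block ks D i)
    fromNeighbours (j , ℓ , ℓ∈B , centre~ℓ) (j′ , c , c∈B , outerLeaf~c)
      with firecrackerAdj-centre i j {toℕ centre} {toℕ ℓ} (toℕ-fromℕ< (≤-trans (s≤s z≤n) (big i))) centre~ℓ
         | firecrackerAdj-outerLeaf i j′ {toℕ outerLeaf} {toℕ c} (≤-reflexive (sym (toℕ-fromℕ< (big i)))) outerLeaf~c
    ... | refl , ℓ≢0 | refl , c≡0 = starDominating⁺ (block ks D i) c≡0 c∈B ℓ≢0 ℓ∈B

  firecracker-totalDominating⇐ : ∀ D → EveryBlockDominating D → TotalDominating (firecracker ks) D
  firecracker-totalDominating⇐ D every v = dominatorFromBlocks v
    (dominatedWithinBlock (proj₁ (decode ks v)) (every (proj₁ (decode ks v))) (toℕ (proj₂ (decode ks v))))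

  dt-firecracker : (∀ i → 3 ≤ lookup ks i) → ∀ i → dt (firecracker ks) i ≡ count everyBlockDominating? i
  dt-firecracker big i = count-cong (totalDominating? (firecracker ks)) everyBlockDominating? i
    (λ D _ → firecracker-totalDominating⇒ big D) (λ D _ → firecracker-totalDominating⇐ D)

PF₂-everyBlockDominating : ∀ {n} (ks : Vec ℕ n) → PF₂ (count (everyBlockDominating? ks))
PF₂-everyBlockDominating []       =
  PF₂-vanishingFrom2 (count (everyBlockDominating? [])) (λ j → count-beyond (everyBlockDominating? []) (2 + j) (s≤s z≤n))
PF₂-everyBlockDominating (k ∷ ks) = PF₂-cong (λ i → sym (firstBlockAndRest i))
  (PF₂-⋆ (count (everyBlockDominating? ks)) (count {k} starDominating?) (PF₂-everyBlockDominating ks) (PF₂-starDominating k))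
  where
  firstBlockAndRest : ∀ i → count (everyBlockDominating? (k ∷ ks)) i
                            ≡ (count (everyBlockDominating? ks) ⋆ count {k} starDominating?) i
  firstBlockAndRest i =
    trans (count-cong (everyBlockDominating? (k ∷ ks))
                      (λ D → starDominating? (take k D) ×-dec everyBlockDominating? ks (drop k D)) i
                      (λ _ _ every → every zero , every ∘ suc) (λ _ _ (first , rest) → ∀-cons first rest))
          (count-take×drop k starDominating? (everyBlockDominating? ks) i)

TDUnimodal-fromPF₂ : ∀ G → PF₂ (dt G) → TDUnimodal G
TDUnimodal-fromPF₂ G pf = PF₂⇒unimodal (dt G) pf (N G)

lollipop-TDUnimodal : ∀ n → 1 ≤ n → TDUnimodal (lollipop n)
lollipop-TDUnimodal (suc n) _ =
  TDUnimodal-fromPF₂ (lollipop (suc n)) (PF₂-cong (λ i → sym (dt-lollipop {n} i)) (PF₂-starDominating (suc (suc n))))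

firecracker-TDUnimodal : ∀ {n} (ks : Vec ℕ n) → (∀ i → 3 ≤ lookup ks i) → TDUnimodal (firecracker ks)
firecracker-TDUnimodal ks big =
  TDUnimodal-fromPF₂ (firecracker ks) (PF₂-cong (λ i → sym (dt-firecracker ks big i)) (PF₂-everyBlockDominating ks))

mainTheorem7 : (n k : ℕ) → 3 ≤ n → 3 ≤ k → (ks : Vec ℕ n) → (∀ (i : Fin n) → 3 ≤ lookup ks i)
    → TDUnimodal (lollipop n) × TDUnimodal (firecrackerUniform n k) × TDUnimodal (firecracker ks)
mainTheorem7 n k 3≤n 3≤k ks 3≤ks =
  lollipop-TDUnimodal n (≤-trans (s≤s z≤n) 3≤n) ,
  firecracker-TDUnimodal (replicate n k) (λ i → subst (3 ≤_) (sym (lookup-replicate i k)) 3≤k) ,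
  firecracker-TDUnimodal ks 3≤ks
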